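{- Let $G=(V,E)$ and $G'=(V',E')$ be finite simple graphs with $V\cap V'=\emptyset$, and let $G\oplus_{v}G'$ be the vertex sum formed by identifying $u\in V$ and $u'\in V'$ into the vertex $v$. Suppose $\hat{S}$ is a maximal failed zero forcing set of $G\oplus_{v}G'$ with $v\notin\hat{S}$. Then $\hat{F}=V(G\oplus_{v}G')\setminus\hat{S}$ is a minimal fort of $G\oplus_{v}G'$ with $v\in\hat{F}$. Moreover, $S=V\cap\hat{S}$ and $S'=V'\cap\hat{S}$ are maximal failed zero forcing sets of $G$ and $G'$, respectively, with $\hat{S}=S\cup S'$; equivalently, $F=V\setminus S$ and $F'=V'\setminus S'$ are minimal forts of $G$ and $G'$, respectively, with $\hat{F}=\left(F\setminus\{u\}\right)\cup\left(F'\setminus\{u'\}\right)\cup\{v\}$.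
   Context: The vertex sum $G\oplus_v G'$ has vertex set $(V\setminus\{u\})\cup(V'\setminus\{u'\})\cup\{v\}$; its edges are those of $G$ not incident to $u$, those of $G'$ not incident to $u'$, and the edges $\{v,w\}$ for $w\in N_G(u)\cup N_{G'}(u')$. A fort of a graph is a non-empty vertex subset $F$ such that no vertex outside $F$ has exactly one neighbor in $F$; it is minimal if no proper subset is a fort. Zero forcing: starting from an initial set of filled vertices, repeatedly apply the rule that a filled vertex $x$ forces a non-filled vertex $w$ if $w$ is the only non-filled neighbor of $x$, until no more forces are possible; the initial set is a zero forcing set if all vertices become filled and a failed zero forcing set otherwise. A failed zero forcing set is maximal if it is not properly contained in another failed zero forcing set. -}

module Defs where

open import Data.Nat using (ℕ; zero; suc; _+_)
open import Data.Bool using (Bool; true; false; T)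
open import Data.Fin using (Fin; zero; suc; punchIn; punchOut; splitAt; _↑ˡ_; _↑ʳ_; _≟_)
open import Data.Fin.Subset using (Subset; _∈_; _∉_; _⊂_; Nonempty)
open import Data.Vec using (tabulate; lookup)
open import Data.Sum using (_⊎_; inj₁; inj₂)
open import Data.Product using (_×_; ∃; _,_)
open import Relation.Nullary using (¬_; yes; no)
open import Relation.Binary.PropositionalEquality using (_≡_; _≢_; refl)

record Graph (n : ℕ) : Set where
  field
    adj    : Fin n → Fin n → Bool
    adj-sym    : ∀ x y → adj x y ≡ adj y x
    adj-irrefl : ∀ x → adj x x ≡ false

open Graph public

Adj : ∀ {n} → Graph n → Fin n → Fin n → Set
Adj G x y = T (adj G x y)

ExactlyOneNbrIn : ∀ {n} → Graph n → Subset n → Fin n → Set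
ExactlyOneNbrIn G F w =
  ∃ λ x → Adj G w x × x ∈ F × (∀ y → Adj G w y → y ∈ F → y ≡ x)

IsFort : ∀ {n} → Graph n → Subset n → Set
IsFort G F = Nonempty F × (∀ w → w ∉ F → ¬ ExactlyOneNbrIn G F w)

IsMinimalFort : ∀ {n} → Graph n → Subset n → Set
IsMinimalFort G F = IsFort G F × (∀ F₀ → F₀ ⊂ F → ¬ IsFort G F₀)

-- Filled G S w : w becomes filled when the zero forcing
-- rule is applied exhaustively starting from S (the final filled set is
-- the least set containing S closed under the forcing rule: a filled
-- vertex x forces its neighbour w once all other neighbours of x are filled).

data Filled {n} (G : Graph n) (S : Subset n) : Fin n → Set where
  initial : ∀ {w} → w ∈ S → Filled G S w
  force   : ∀ x w → Filled G S x → Adj G x w →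
            (∀ y → Adj G x y → y ≢ w → Filled G S y) → Filled G S w

IsZeroForcingSet : ∀ {n} → Graph n → Subset n → Set
IsZeroForcingSet G S = ∀ w → Filled G S w

IsFailedZeroForcingSet : ∀ {n} → Graph n → Subset n → Set
IsFailedZeroForcingSet G S = ¬ IsZeroForcingSet G S

IsMaximalFailedZeroForcingSet : ∀ {n} → Graph n → Subset n → Set
IsMaximalFailedZeroForcingSet G S =
  IsFailedZeroForcingSet G S × (∀ T → S ⊂ T → ¬ IsFailedZeroForcingSet G T)

-- G ⊕ G' lives on Fin (suc (n + m)):
--   zero            is the identified vertex v,
--   suc (i ↑ˡ m)    is the vertex punchIn u i of G   (i.e. vertices ≠ u),
--   suc (n ↑ʳ j)    is the vertex punchIn u' j of G' (i.e. vertices ≠ u').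

data Part (n m : ℕ) : Set where
  hubP   : Part n m
  leftP  : Fin n → Part n m
  rightP : Fin m → Part n m

part : ∀ {n m} → Fin (suc (n + m)) → Part n m
part zero = hubP
part {n} (suc k) with splitAt n k
... | inj₁ i = leftP i
... | inj₂ j = rightP j

module _ {n m : ℕ} (G : Graph (suc n)) (u : Fin (suc n))
                   (G' : Graph (suc m)) (u' : Fin (suc m)) where

  sumAdjP : Part n m → Part n m → Bool
  sumAdjP hubP       hubP       = false
  sumAdjP hubP       (leftP i)  = adj G u (punchIn u i)
  sumAdjP hubP       (rightP j) = adj G' u' (punchIn u' j)
  sumAdjP (leftP i)  hubP       = adj G (punchIn u i) u
  sumAdjP (leftP i)  (leftP k)  = adj G (punchIn u i) (punchIn u k)
  sumAdjP (leftP i)  (rightP j) = false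
  sumAdjP (rightP j) hubP       = adj G' (punchIn u' j) u'
  sumAdjP (rightP j) (leftP i)  = false
  sumAdjP (rightP j) (rightP k) = adj G' (punchIn u' j) (punchIn u' k)

  private
    symP : ∀ p q → sumAdjP p q ≡ sumAdjP q p
    symP hubP       hubP       = refl
    symP hubP       (leftP i)  = Graph.adj-sym G u (punchIn u i)
    symP hubP       (rightP j) = Graph.adj-sym G' u' (punchIn u' j)
    symP (leftP i)  hubP       = Graph.adj-sym G (punchIn u i) u
    symP (leftP i)  (leftP k)  = Graph.adj-sym G (punchIn u i) (punchIn u k)
    symP (leftP i)  (rightP j) = refl
    symP (rightP j) hubP       = Graph.adj-sym G' (punchIn u' j) u'
    symP (rightP j) (leftP i)  = refl
    symP (rightP j) (rightP k) = Graph.adj-sym G' (punchIn u' j) (punchIn u' k)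

    irreflP : ∀ p → sumAdjP p p ≡ false
    irreflP hubP       = refl
    irreflP (leftP i)  = Graph.adj-irrefl G (punchIn u i)
    irreflP (rightP j) = Graph.adj-irrefl G' (punchIn u' j)

  vertexSum : Graph (suc (n + m))
  vertexSum = record
    { adj        = λ x y → sumAdjP (part x) (part y)
    ; adj-sym    = λ x y → symP (part x) (part y)
    ; adj-irrefl = λ x → irreflP (part x)
    }

hub : ∀ {n m} → Fin (suc (n + m))
hub = zero

embL : ∀ {n} m → Fin (suc n) → Fin (suc n) → Fin (suc (n + m))
embL m u x with u ≟ x
... | yes _  = zero
... | no u≢x = suc (punchOut u≢x ↑ˡ m)

embR : ∀ n {m} → Fin (suc m) → Fin (suc m) → Fin (suc (n + m))
embR n u' y with u' ≟ y
... | yes _   = zero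
... | no u'≢y = suc (n ↑ʳ punchOut u'≢y)

restrictL : ∀ {n} m → Fin (suc n) → Subset (suc (n + m)) → Subset (suc n)
restrictL m u Ŝ = tabulate (λ x → lookup Ŝ (embL m u x))

restrictR : ∀ n {m} → Fin (suc m) → Subset (suc (n + m)) → Subset (suc m)
restrictR n u' Ŝ = tabulate (λ y → lookup Ŝ (embR n u' y))

{-# OPTIONS --safe #-}
module Submission where

-- A set S is a maximal failed zero forcing set exactly when its complement is a
-- minimal fort: a fort disjoint from S is never filled, and the vertices a failed
-- set leaves unfilled always form a fort.  It therefore suffices to restrict the
-- minimal fort F̂ ∋ v of G ⊕ G' to each summand.  A summand embeds into the sum
-- preserving adjacency and touches the rest of the sum only through v, so the
-- restriction F is again a fort; and a fort F₀ ⊊ F of G, enlarged by the part of F̂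
-- beyond v whenever u ∈ F₀, would be a fort strictly inside F̂.

open import Defs
open import Data.Nat using (ℕ; suc; _+_)
open import Data.Bool using (Bool; true; T)
open import Data.Fin using (Fin; zero; suc; punchIn; punchOut; splitAt; _↑ˡ_; _↑ʳ_; _≟_)
open import Data.Fin.Properties
  using (any?; ¬∀⟶∃¬; 0≢1+n; suc-injective; ↑ˡ-injective; ↑ʳ-injective; splitAt-↑ˡ; splitAt-↑ʳ;
         splitAt⁻¹-↑ˡ; splitAt⁻¹-↑ʳ; punchInᵢ≢i; punchIn-punchOut; punchOut-cong; punchOut-punchIn)
open import Data.Fin.Subset using (Subset; _∈_; _∉_; _⊆_; _⊂_; ∁; Nonempty)
open import Data.Fin.Subset.Properties using (_∈?_; x∈∁p⇒x∉p; x∉p⇒x∈∁p; x∉∁p⇒x∈p; x∈p⇒x∉∁p)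
open import Data.Product using (_×_; ∃; _,_; proj₂)
open import Data.Sum using (_⊎_; inj₁; inj₂; [_,_]′)
open import Data.Vec using (tabulate; lookup)
open import Data.Vec.Properties using (lookup∘tabulate; []=⇒lookup; lookup⇒[]=)
open import Function using (_∘_)
open import Function.Bundles using (_⇔_; mk⇔; Equivalence)
open import Function.Definitions using (Injective)
open import Level using (Level)
open import Relation.Nullary using (¬_; yes; no; does; contradiction)
open import Relation.Nullary.Decidable
  using (¬?; _×-dec_; _⊎-dec_; dec-true; decidable-stable; ¬¬-excluded-middle)
open import Relation.Unary using (Pred; Decidable)
open import Relation.Binary.PropositionalEquality
  using (_≡_; _≢_; refl; sym; trans; cong; cong₂; subst; module ≡-Reasoning)

open Equivalence using (to; from)
open ≡-Reasoning

private
  variable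
    ℓ : Level
    n : ℕ

∈-tabulate⁺ : (f : Fin n → Bool) {x : Fin n} → f x ≡ true → x ∈ tabulate f
∈-tabulate⁺ f {x} fx = lookup⇒[]= x (tabulate f) (trans (lookup∘tabulate f x) fx)

∈-tabulate⁻ : (f : Fin n → Bool) {x : Fin n} → x ∈ tabulate f → f x ≡ true
∈-tabulate⁻ f {x} x∈ = trans (sym (lookup∘tabulate f x)) ([]=⇒lookup x∈)

toSubset : {P : Pred (Fin n) ℓ} → Decidable P → Subset n
toSubset P? = tabulate (does ∘ P?)

module _ {P : Pred (Fin n) ℓ} (P? : Decidable P) {x : Fin n} where

  ∈-toSubset⁺ : P x → x ∈ toSubset P?
  ∈-toSubset⁺ px = ∈-tabulate⁺ (does ∘ P?) (dec-true (P? x) px)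

  ∈-toSubset⁻ : x ∈ toSubset P? → P x
  ∈-toSubset⁻ x∈ with P? x | ∈-tabulate⁻ (does ∘ P?) x∈
  ... | yes px | _  = px
  ... | no _   | ()

preimage : ∀ {m} → (Fin m → Fin n) → Subset n → Subset m
preimage e S = tabulate (λ x → lookup S (e x))

module _ {m} (e : Fin m → Fin n) {S : Subset n} {x : Fin m} where

  ∈-preimage : x ∈ preimage e S ⇔ e x ∈ S
  ∈-preimage = mk⇔ (lookup⇒[]= (e x) S ∘ ∈-tabulate⁻ _) (∈-tabulate⁺ _ ∘ []=⇒lookup)

  ∈-∁-preimage : x ∈ ∁ (preimage e S) ⇔ e x ∈ ∁ S
  ∈-∁-preimage = mk⇔
    (λ x∈ → x∉p⇒x∈∁p (x∈∁p⇒x∉p x∈ ∘ from ∈-preimage))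
    (λ ex∈ → x∉p⇒x∈∁p (x∈∁p⇒x∉p ex∈ ∘ to ∈-preimage))

¬¬-decidable : (P : Pred (Fin n) ℓ) → ¬ ¬ Decidable P
¬¬-decidable {n = 0} P k = k λ ()
¬¬-decidable {n = suc n} P k =
  ¬¬-excluded-middle λ P₀? →
  ¬¬-decidable (P ∘ suc) λ Pₛ? →
  k λ { zero → P₀? ; (suc x) → Pₛ? x }

Adj-sym : ∀ (H : Graph n) {x y} → Adj H x y → Adj H y x
Adj-sym H {x} {y} = subst T (adj-sym H x y)

-- Maximal failed zero forcing sets are the complements of minimal forts

module _ (H : Graph n) where

  Filled-trans : ∀ {S T} → (∀ {x} → x ∈ T → Filled H S x) → ∀ {w} → Filled H T w → Filled H S w
  Filled-trans T-filled (initial w∈T)         = T-filled w∈T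
  Filled-trans T-filled (force x w fx x~w rest) =
    force x w (Filled-trans T-filled fx) x~w (λ y x~y y≢w → Filled-trans T-filled (rest y x~y y≢w))

  Filled-sole-neighbour : ∀ {S F w x} → (∀ {y} → y ∉ F → Filled H S y) → Filled H S w →
                          Adj H w x → (∀ y → Adj H w y → y ∈ F → y ≡ x) → Filled H S x
  Filled-sole-neighbour {x = x} outside-filled fw w~x sole =
    force _ x fw w~x (λ y w~y y≢x → outside-filled (y≢x ∘ sole y w~y))

  -- The first vertex of F to be filled would be forced by a vertex outside F
  -- having it as its only neighbour in F.
  fort-unfilled : ∀ {F S} → IsFort H F → (∀ {x} → x ∈ S → x ∉ F) → ∀ {w} → Filled H S w → w ∉ F
  fort-unfilled fort S∩F=∅ (initial w∈S) = S∩F=∅ w∈S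
  fort-unfilled {F} fort S∩F=∅ (force x w fx x~w rest) w∈F =
    proj₂ fort x (fort-unfilled fort S∩F=∅ fx) (w , x~w , w∈F , sole)
    where
      sole : ∀ y → Adj H x y → y ∈ F → y ≡ w
      sole y x~y y∈F with y ≟ w
      ... | yes y≡w = y≡w
      ... | no  y≢w = contradiction y∈F (fort-unfilled fort S∩F=∅ (rest y x~y y≢w))

  fort-disjoint⇒failed : ∀ {F S} → IsFort H F → (∀ {x} → x ∈ S → x ∉ F) → IsFailedZeroForcingSet H S
  fort-disjoint⇒failed fort@((x , x∈F) , _) S∩F=∅ zfs = fort-unfilled fort S∩F=∅ (zfs x) x∈F

  failed⇒∁-nonempty : ∀ {S} → IsFailedZeroForcingSet H S → Nonempty (∁ S)
  failed⇒∁-nonempty {S} failed with ¬∀⟶∃¬ n (_∈ S) (_∈? S) (λ all∈S → failed (initial ∘ all∈S))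
  ... | x , x∉S = x , x∉p⇒x∈∁p x∉S

  maximalFailed-closed : ∀ {S} → IsMaximalFailedZeroForcingSet H S → ∀ {w} → w ∉ S → ¬ Filled H S w
  maximalFailed-closed {S} (failed , maximal) {w} w∉S fw =
    maximal S∪w (∈-toSubset⁺ S∪w? ∘ inj₁ , w , ∈-toSubset⁺ S∪w? (inj₂ refl) , w∉S)
      (failed ∘ zfs-S∪w⇒zfs-S)
    where
      S∪w? : Decidable (λ x → x ∈ S ⊎ x ≡ w)
      S∪w? x = (x ∈? S) ⊎-dec (x ≟ w)
      S∪w : Subset n
      S∪w = toSubset S∪w?
      zfs-S∪w⇒zfs-S : IsZeroForcingSet H S∪w → IsZeroForcingSet H S
      zfs-S∪w⇒zfs-S zfs x =
        Filled-trans (λ x∈ → [ initial , (λ { refl → fw }) ]′ (∈-toSubset⁻ S∪w? x∈)) (zfs x)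

  unfilled : ∀ {T} → Decidable (Filled H T) → Subset n
  unfilled Filled? = toSubset (¬? ∘ Filled?)

  unfilled-fort : ∀ {T} (Filled? : Decidable (Filled H T)) → IsFailedZeroForcingSet H T →
                  IsFort H (unfilled Filled?)
  unfilled-fort {T} Filled? failed = nonempty , no-sole-neighbour
    where
      U : Subset n
      U = unfilled Filled?
      ∉U⇒Filled : ∀ {w} → w ∉ U → Filled H T w
      ∉U⇒Filled {w} w∉U = decidable-stable (Filled? w) (w∉U ∘ ∈-toSubset⁺ (¬? ∘ Filled?))
      nonempty : Nonempty U
      nonempty with ¬∀⟶∃¬ n (Filled H T) Filled? failed
      ... | w , w-unfilled = w , ∈-toSubset⁺ (¬? ∘ Filled?) w-unfilled
      no-sole-neighbour : ∀ w → w ∉ U → ¬ ExactlyOneNbrIn H U w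
      no-sole-neighbour w w∉U (x , w~x , x∈U , sole) =
        ∈-toSubset⁻ (¬? ∘ Filled?) x∈U (Filled-sole-neighbour ∉U⇒Filled (∉U⇒Filled w∉U) w~x sole)

  maximalFailed⇒minimalFort : ∀ {S} → IsMaximalFailedZeroForcingSet H S → IsMinimalFort H (∁ S)
  maximalFailed⇒minimalFort {S} maxS@(failed , maximal) =
    (failed⇒∁-nonempty failed , no-sole-neighbour) , minimal
    where
      no-sole-neighbour : ∀ w → w ∉ ∁ S → ¬ ExactlyOneNbrIn H (∁ S) w
      no-sole-neighbour w w∉∁S (x , w~x , x∈∁S , sole) =
        maximalFailed-closed maxS (x∈∁p⇒x∉p x∈∁S)
          (Filled-sole-neighbour (initial ∘ x∉∁p⇒x∈p) (initial (x∉∁p⇒x∈p w∉∁S)) w~x sole)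
      minimal : ∀ F₀ → F₀ ⊂ ∁ S → ¬ IsFort H F₀
      minimal F₀ (F₀⊆∁S , x , x∈∁S , x∉F₀) fort₀ =
        maximal (∁ F₀) (S⊆∁F₀ , x , x∉p⇒x∈∁p x∉F₀ , x∈∁p⇒x∉p x∈∁S)
          (fort-disjoint⇒failed fort₀ x∈∁p⇒x∉p)
        where
          S⊆∁F₀ : S ⊆ ∁ F₀
          S⊆∁F₀ y∈S = x∉p⇒x∈∁p (λ y∈F₀ → x∈∁p⇒x∉p (F₀⊆∁S y∈F₀) y∈S)

  minimalFort⇒maximalFailed : ∀ {S} → IsMinimalFort H (∁ S) → IsMaximalFailedZeroForcingSet H S
  minimalFort⇒maximalFailed {S} (fort , minimal) = fort-disjoint⇒failed fort x∈p⇒x∉∁p , maximal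
    where
      maximal : ∀ T → S ⊂ T → ¬ IsFailedZeroForcingSet H T
      maximal T (S⊆T , x , x∈T , x∉S) failed = ¬¬-decidable (Filled H T) λ Filled? →
        minimal (unfilled Filled?)
          ( (λ w∈U → x∉p⇒x∈∁p (∈-toSubset⁻ (¬? ∘ Filled?) w∈U ∘ initial ∘ S⊆T))
          , x , x∉p⇒x∈∁p x∉S , (λ x∈U → ∈-toSubset⁻ (¬? ∘ Filled?) x∈U (initial x∈T)))
          (unfilled-fort Filled? failed)

-- Pulling minimal forts back along an embedding attached at a single vertex

module Pullback {K N} (H : Graph K) (G : Graph N) (u : Fin N) (emb : Fin N → Fin K)
  (emb-injective : Injective _≡_ _≡_ emb)
  (adj-emb : ∀ x y → adj H (emb x) (emb y) ≡ adj G x y)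
  (attached-at-u : ∀ {w x} → ¬ (∃ λ y → emb y ≡ w) → Adj H w (emb x) → x ≡ u)
  where

  Adj-emb⁺ : ∀ {x y} → Adj G x y → Adj H (emb x) (emb y)
  Adj-emb⁺ {x} {y} = subst T (sym (adj-emb x y))

  Adj-emb⁻ : ∀ {x y} → Adj H (emb x) (emb y) → Adj G x y
  Adj-emb⁻ {x} {y} = subst T (adj-emb x y)

  OffImage : Pred (Fin K) _
  OffImage w = ¬ (∃ λ x → emb x ≡ w)

  data ImageView : Fin K → Set where
    image    : ∀ x → ImageView (emb x)
    offImage : ∀ {w} → OffImage w → ImageView w

  imageView : ∀ w → ImageView w
  imageView w with any? (λ x → emb x ≟ w)
  ... | yes (x , refl) = image x
  ... | no  off        = offImage off

  pullback-fort : ∀ {F̂ F} → IsFort H F̂ → emb u ∈ F̂ → (∀ {x} → x ∈ F ⇔ emb x ∈ F̂) → IsFort G F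
  pullback-fort {F̂} {F} (_ , fortĤ) u∈F̂ F≡ = (u , from F≡ u∈F̂) , no-sole-neighbour
    where
      no-sole-neighbour : ∀ w → w ∉ F → ¬ ExactlyOneNbrIn G F w
      no-sole-neighbour w w∉F (x , w~x , x∈F , sole) =
        fortĤ (emb w) (w∉F ∘ from F≡) (emb x , Adj-emb⁺ w~x , to F≡ x∈F , soleĤ)
        where
          soleĤ : ∀ y → Adj H (emb w) y → y ∈ F̂ → y ≡ emb x
          soleĤ y ew~y y∈F̂ with imageView y
          ... | image y′    = cong emb (sole y′ (Adj-emb⁻ ew~y) (from F≡ y∈F̂))
          ... | offImage off with attached-at-u off (Adj-sym H ew~y)
          ...   | refl = contradiction (from F≡ u∈F̂) w∉F

  -- When u ∈ F₀, a vertex off the image has the same neighbours in push as in F̂;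
  -- otherwise it has none.
  module Push {F̂ F} (F≡ : ∀ {x} → x ∈ F ⇔ emb x ∈ F̂) {F₀} (F₀⊆F : F₀ ⊆ F) where

    InPush : Pred (Fin K) _
    InPush w = (∃ λ x → emb x ≡ w × x ∈ F₀) ⊎ (OffImage w × u ∈ F₀ × w ∈ F̂)

    InPush? : Decidable InPush
    InPush? w = any? (λ x → (emb x ≟ w) ×-dec (x ∈? F₀))
           ⊎-dec (¬? (any? (λ x → emb x ≟ w)) ×-dec (u ∈? F₀) ×-dec (w ∈? F̂))

    push : Subset K
    push = toSubset InPush?

    emb∈push⁺ : ∀ {x} → x ∈ F₀ → emb x ∈ push
    emb∈push⁺ {x} x∈F₀ = ∈-toSubset⁺ InPush? (inj₁ (x , refl , x∈F₀))

    emb∈push⁻ : ∀ {x} → emb x ∈ push → x ∈ F₀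
    emb∈push⁻ {x} ex∈ with ∈-toSubset⁻ InPush? ex∈
    ... | inj₁ (x′ , ex′≡ex , x′∈F₀) = subst (_∈ F₀) (emb-injective ex′≡ex) x′∈F₀
    ... | inj₂ (off , _)            = contradiction (x , refl) off

    off∈push⁺ : ∀ {w} → OffImage w → u ∈ F₀ → w ∈ F̂ → w ∈ push
    off∈push⁺ off u∈F₀ w∈F̂ = ∈-toSubset⁺ InPush? (inj₂ (off , u∈F₀ , w∈F̂))

    off∈push⁻ : ∀ {w} → OffImage w → w ∈ push → u ∈ F₀
    off∈push⁻ off w∈ with ∈-toSubset⁻ InPush? w∈
    ... | inj₁ (x , refl , _) = contradiction (x , refl) off
    ... | inj₂ (_ , u∈F₀ , _) = u∈F₀

    push⊆F̂ : push ⊆ F̂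
    push⊆F̂ w∈ with ∈-toSubset⁻ InPush? w∈
    ... | inj₁ (x , refl , x∈F₀) = to F≡ (F₀⊆F x∈F₀)
    ... | inj₂ (_ , _ , w∈F̂)     = w∈F̂

    nbr-of-off∈push⇒u∈F₀ : ∀ {w z} → OffImage w → Adj H w z → z ∈ push → u ∈ F₀
    nbr-of-off∈push⇒u∈F₀ {z = z} off w~z z∈ with imageView z
    ... | image z′      = subst (_∈ F₀) (attached-at-u off w~z) (emb∈push⁻ z∈)
    ... | offImage off′ = off∈push⁻ off′ z∈

    nbr-of-off∈F̂⇒∈push : ∀ {w y} → OffImage w → u ∈ F₀ → Adj H w y → y ∈ F̂ → y ∈ push
    nbr-of-off∈F̂⇒∈push {y = y} off u∈F₀ w~y y∈F̂ with imageView y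
    ... | image y′      = emb∈push⁺ (subst (_∈ F₀) (sym (attached-at-u off w~y)) u∈F₀)
    ... | offImage off′ = off∈push⁺ off′ u∈F₀ y∈F̂

    push-fort : IsFort H F̂ → IsFort G F₀ → IsFort H push
    push-fort (_ , fortĤ) ((x₀ , x₀∈F₀) , fort₀) = (emb x₀ , emb∈push⁺ x₀∈F₀) , no-sole-neighbour
      where
        no-sole-neighbour : ∀ w → w ∉ push → ¬ ExactlyOneNbrIn H push w
        no-sole-neighbour w w∉ (z , w~z , z∈ , sole) with imageView w | imageView z
        ... | image x | image z′ =
          fort₀ x (w∉ ∘ emb∈push⁺) (z′ , Adj-emb⁻ w~z , emb∈push⁻ z∈ ,
            λ y x~y y∈F₀ → emb-injective (sole (emb y) (Adj-emb⁺ x~y) (emb∈push⁺ y∈F₀)))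
        ... | image x | offImage off′ =
          w∉ (emb∈push⁺ (subst (_∈ F₀) (sym (attached-at-u off′ (Adj-sym H w~z)))
                                (off∈push⁻ off′ z∈)))
        ... | offImage off | _ =
          fortĤ w (w∉ ∘ off∈push⁺ off u∈F₀) (z , w~z , push⊆F̂ z∈ ,
            λ y w~y y∈F̂ → sole y w~y (nbr-of-off∈F̂⇒∈push off u∈F₀ w~y y∈F̂))
          where
            u∈F₀ : u ∈ F₀
            u∈F₀ = nbr-of-off∈push⇒u∈F₀ off w~z z∈

  pullback-minimalFort : ∀ {F̂ F} → IsMinimalFort H F̂ → emb u ∈ F̂ → (∀ {x} → x ∈ F ⇔ emb x ∈ F̂) →
                         IsMinimalFort G F
  pullback-minimalFort {F̂} {F} (fortĤ , minimalĤ) u∈F̂ F≡ = pullback-fort fortĤ u∈F̂ F≡ , minimal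
    where
      minimal : ∀ F₀ → F₀ ⊂ F → ¬ IsFort G F₀
      minimal F₀ (F₀⊆F , x , x∈F , x∉F₀) fort₀ =
        minimalĤ push (push⊆F̂ , emb x , to F≡ x∈F , x∉F₀ ∘ emb∈push⁻) (push-fort fortĤ fort₀)
        where open Push F≡ F₀⊆F

  pullback-maximalFailed : ∀ {Ŝ} → IsMaximalFailedZeroForcingSet H Ŝ → emb u ∉ Ŝ →
                           IsMaximalFailedZeroForcingSet G (preimage emb Ŝ)
  pullback-maximalFailed maxŜ u∉Ŝ = minimalFort⇒maximalFailed G
    (pullback-minimalFort (maximalFailed⇒minimalFort H maxŜ) (x∉p⇒x∈∁p u∉Ŝ) (∈-∁-preimage emb))

data PunchView {N} (u : Fin (suc N)) : Fin (suc N) → Set where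
  atU     : PunchView u u
  punched : ∀ i → PunchView u (punchIn u i)

punchView : ∀ {N} (u x : Fin (suc N)) → PunchView u x
punchView u x with u ≟ x
... | yes refl = atU
... | no  u≢x  = subst (PunchView u) (punchIn-punchOut u≢x) (punched (punchOut u≢x))

module PunchedEmbedding {K N} (H : Graph K) (G : Graph (suc N)) (u : Fin (suc N))
  (emb : Fin (suc N) → Fin K) (ι : Fin N → Fin K)
  (emb-punchIn : ∀ i → emb (punchIn u i) ≡ ι i)
  (ι-injective : Injective _≡_ _≡_ ι)
  (ι≢emb-u : ∀ i → ι i ≢ emb u)
  (adj-emb-u-ι : ∀ i → adj H (emb u) (ι i) ≡ adj G u (punchIn u i))
  (adj-ι-ι : ∀ i k → adj H (ι i) (ι k) ≡ adj G (punchIn u i) (punchIn u k))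
  (ι-nbrs-in-image : ∀ {i w} → Adj H (ι i) w → ∃ λ x → emb x ≡ w)
  where

  private
    emb-injective-view : ∀ {x y} → PunchView u x → PunchView u y → emb x ≡ emb y → x ≡ y
    emb-injective-view atU         atU         _ = refl
    emb-injective-view atU         (punched k) e =
      contradiction (trans (sym (emb-punchIn k)) (sym e)) (ι≢emb-u k)
    emb-injective-view (punched i) atU         e =
      contradiction (trans (sym (emb-punchIn i)) e) (ι≢emb-u i)
    emb-injective-view (punched i) (punched k) e =
      cong (punchIn u) (ι-injective (trans (sym (emb-punchIn i)) (trans e (emb-punchIn k))))

    adj-emb-view : ∀ {x y} → PunchView u x → PunchView u y → adj H (emb x) (emb y) ≡ adj G x y
    adj-emb-view atU         atU         = trans (adj-irrefl H (emb u)) (sym (adj-irrefl G u))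
    adj-emb-view atU         (punched k) =
      trans (cong (adj H (emb u)) (emb-punchIn k)) (adj-emb-u-ι k)
    adj-emb-view (punched i) atU         = begin
      adj H (emb (punchIn u i)) (emb u) ≡⟨ adj-sym H _ _ ⟩
      adj H (emb u) (emb (punchIn u i)) ≡⟨ adj-emb-view atU (punched i) ⟩
      adj G u (punchIn u i)             ≡⟨ adj-sym G _ _ ⟩
      adj G (punchIn u i) u             ∎
    adj-emb-view (punched i) (punched k) =
      trans (cong₂ (adj H) (emb-punchIn i) (emb-punchIn k)) (adj-ι-ι i k)

  emb-injective : Injective _≡_ _≡_ emb
  emb-injective {x} {y} = emb-injective-view (punchView u x) (punchView u y)

  adj-emb : ∀ x y → adj H (emb x) (emb y) ≡ adj G x y
  adj-emb x y = adj-emb-view (punchView u x) (punchView u y)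

  attached-at-u : ∀ {w x} → ¬ (∃ λ y → emb y ≡ w) → Adj H w (emb x) → x ≡ u
  attached-at-u {w} {x} off w~x with punchView u x
  ... | atU       = refl
  ... | punched i =
    contradiction (ι-nbrs-in-image (Adj-sym H (subst (Adj H w) (emb-punchIn i) w~x))) off

  open Pullback H G u emb emb-injective adj-emb attached-at-u public using (pullback-maximalFailed)

module VertexSum {n m} (G : Graph (suc n)) (u : Fin (suc n))
                       (G' : Graph (suc m)) (u' : Fin (suc m)) where

  H : Graph (suc (n + m))
  H = vertexSum G u G' u'

  inL : Fin n → Fin (suc (n + m))
  inL i = suc (i ↑ˡ m)

  inR : Fin m → Fin (suc (n + m))
  inR j = suc (n ↑ʳ j)

  data VertexView : Fin (suc (n + m)) → Set where
    hubV   : VertexView (hub {n} {m})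
    leftV  : ∀ i → VertexView (inL i)
    rightV : ∀ j → VertexView (inR j)

  vertexView : ∀ w → VertexView w
  vertexView zero = hubV
  vertexView (suc k) with splitAt n k in eq
  ... | inj₁ i = subst (VertexView ∘ suc) (splitAt⁻¹-↑ˡ eq) (leftV i)
  ... | inj₂ j = subst (VertexView ∘ suc) (splitAt⁻¹-↑ʳ eq) (rightV j)

  part-inL : ∀ i → part {n} {m} (inL i) ≡ leftP i
  part-inL i rewrite splitAt-↑ˡ n i m = refl

  part-inR : ∀ j → part {n} {m} (inR j) ≡ rightP j
  part-inR j rewrite splitAt-↑ʳ n m j = refl

  ¬Adj-inL-inR : ∀ i j → ¬ Adj H (inL i) (inR j)
  ¬Adj-inL-inR i j rewrite part-inL i | part-inR j = λ ()

  ¬Adj-inR-inL : ∀ j i → ¬ Adj H (inR j) (inL i)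
  ¬Adj-inR-inL j i = ¬Adj-inL-inR i j ∘ Adj-sym H {inR j} {inL i}

  embL-u : embL m u u ≡ hub {n} {m}
  embL-u with u ≟ u
  ... | yes _   = refl
  ... | no  u≢u = contradiction refl u≢u

  embL-punchIn : ∀ i → embL m u (punchIn u i) ≡ inL i
  embL-punchIn i with u ≟ punchIn u i
  ... | yes u≡ = contradiction (sym u≡) (punchInᵢ≢i u i)
  ... | no  _  = cong (λ k → suc (k ↑ˡ m)) (trans (punchOut-cong u refl) (punchOut-punchIn u))

  embR-u : embR n u' u' ≡ hub {n} {m}
  embR-u with u' ≟ u'
  ... | yes _     = refl
  ... | no  u'≢u' = contradiction refl u'≢u'

  embR-punchIn : ∀ j → embR n u' (punchIn u' j) ≡ inR j
  embR-punchIn j with u' ≟ punchIn u' j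
  ... | yes u'≡ = contradiction (sym u'≡) (punchInᵢ≢i u' j)
  ... | no  _   = cong (λ k → suc (n ↑ʳ k)) (trans (punchOut-cong u' refl) (punchOut-punchIn u'))

  inL-nbrs-in-image : ∀ {i w} → Adj H (inL i) w → ∃ λ x → embL m u x ≡ w
  inL-nbrs-in-image {i} {w} i~w with vertexView w
  ... | hubV     = u , embL-u
  ... | leftV k  = punchIn u k , embL-punchIn k
  ... | rightV j = contradiction i~w (¬Adj-inL-inR i j)

  inR-nbrs-in-image : ∀ {j w} → Adj H (inR j) w → ∃ λ y → embR n u' y ≡ w
  inR-nbrs-in-image {j} {w} j~w with vertexView w
  ... | hubV     = u' , embR-u
  ... | leftV i  = contradiction j~w (¬Adj-inR-inL j i)
  ... | rightV k = punchIn u' k , embR-punchIn k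

  module Left = PunchedEmbedding H G u (embL m u) inL embL-punchIn
    (↑ˡ-injective m _ _ ∘ suc-injective)
    (λ i i≡ → 0≢1+n (sym (trans i≡ embL-u)))
    (λ i → cong₂ (sumAdjP G u G' u') (cong part embL-u) (part-inL i))
    (λ i k → cong₂ (sumAdjP G u G' u') (part-inL i) (part-inL k))
    inL-nbrs-in-image

  module Right = PunchedEmbedding H G' u' (embR n u') inR embR-punchIn
    (↑ʳ-injective n _ _ ∘ suc-injective)
    (λ j j≡ → 0≢1+n (sym (trans j≡ embR-u)))
    (λ j → cong₂ (sumAdjP G u G' u') (cong part embR-u) (part-inR j))
    (λ j k → cong₂ (sumAdjP G u G' u') (part-inR j) (part-inR k))
    inR-nbrs-in-image

  module Split (Ŝ : Subset (suc (n + m))) where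

    S∪S' : Pred (Fin (suc (n + m))) _
    S∪S' w = (∃ λ x → x ∈ preimage (embL m u) Ŝ × embL m u x ≡ w)
           ⊎ (∃ λ y → y ∈ preimage (embR n u') Ŝ × embR n u' y ≡ w)

    F∪F'∪v : Pred (Fin (suc (n + m))) _
    F∪F'∪v w = (∃ λ x → x ∈ ∁ (preimage (embL m u) Ŝ) × x ≢ u × embL m u x ≡ w)
             ⊎ (∃ λ y → y ∈ ∁ (preimage (embR n u') Ŝ) × y ≢ u' × embR n u' y ≡ w)
             ⊎ w ≡ hub {n} {m}

    module _ (hub∉Ŝ : hub {n} {m} ∉ Ŝ) where

      Ŝ-split : ∀ w → w ∈ Ŝ ⇔ S∪S' w
      Ŝ-split w = mk⇔ (split (vertexView w)) join
        where
          split : ∀ {w} → VertexView w → w ∈ Ŝ → S∪S' w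
          split hubV       v∈Ŝ = contradiction v∈Ŝ hub∉Ŝ
          split (leftV i)  w∈Ŝ =
            inj₁ ( punchIn u i
                 , from (∈-preimage (embL m u)) (subst (_∈ Ŝ) (sym (embL-punchIn i)) w∈Ŝ)
                 , embL-punchIn i)
          split (rightV j) w∈Ŝ =
            inj₂ ( punchIn u' j
                 , from (∈-preimage (embR n u')) (subst (_∈ Ŝ) (sym (embR-punchIn j)) w∈Ŝ)
                 , embR-punchIn j)
          join : S∪S' w → w ∈ Ŝ
          join (inj₁ (x , x∈S  , refl)) = to (∈-preimage (embL m u)) x∈S
          join (inj₂ (y , y∈S' , refl)) = to (∈-preimage (embR n u')) y∈S'

      F̂-split : ∀ w → w ∈ ∁ Ŝ ⇔ F∪F'∪v w
      F̂-split w = mk⇔ (split (vertexView w)) join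
        where
          split : ∀ {w} → VertexView w → w ∈ ∁ Ŝ → F∪F'∪v w
          split hubV       _   = inj₂ (inj₂ refl)
          split (leftV i)  w∈F̂ =
            inj₁ ( punchIn u i
                 , from (∈-∁-preimage (embL m u)) (subst (_∈ ∁ Ŝ) (sym (embL-punchIn i)) w∈F̂)
                 , punchInᵢ≢i u i , embL-punchIn i)
          split (rightV j) w∈F̂ =
            inj₂ (inj₁ ( punchIn u' j
                       , from (∈-∁-preimage (embR n u')) (subst (_∈ ∁ Ŝ) (sym (embR-punchIn j)) w∈F̂)
                       , punchInᵢ≢i u' j , embR-punchIn j))
          join : F∪F'∪v w → w ∈ ∁ Ŝ
          join (inj₁ (x , x∈F , _ , refl))         = to (∈-∁-preimage (embL m u)) x∈F
          join (inj₂ (inj₁ (y , y∈F' , _ , refl))) = to (∈-∁-preimage (embR n u')) y∈F'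
          join (inj₂ (inj₂ refl))                  = x∉p⇒x∈∁p hub∉Ŝ

proposition5p8 :
    ∀ {n m} (G : Graph (suc n)) (u : Fin (suc n))
      (G' : Graph (suc m)) (u' : Fin (suc m))
      (Ŝ : Subset (suc (n + m))) →
    IsMaximalFailedZeroForcingSet (vertexSum G u G' u') Ŝ →
    hub {n} {m} ∉ Ŝ →
    let S  = restrictL m u Ŝ
        S' = restrictR n u' Ŝ
    in
    -- F̂ = V(G ⊕ G') ∖ Ŝ is a minimal fort containing v
    (IsMinimalFort (vertexSum G u G' u') (∁ Ŝ) × hub {n} {m} ∈ ∁ Ŝ)
    -- S = V ∩ Ŝ, S' = V' ∩ Ŝ are maximal failed zero forcing sets, Ŝ = S ∪ S'
    × (IsMaximalFailedZeroForcingSet G S × IsMaximalFailedZeroForcingSet G' S'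
       × (∀ w → w ∈ Ŝ ⇔ ((∃ λ x → x ∈ S × embL m u x ≡ w)
                          ⊎ (∃ λ y → y ∈ S' × embR n u' y ≡ w))))
    -- F = V ∖ S, F' = V' ∖ S' are minimal forts, F̂ = (F∖{u}) ∪ (F'∖{u'}) ∪ {v}
    × (IsMinimalFort G (∁ S) × IsMinimalFort G' (∁ S')
       × (∀ w → w ∈ ∁ Ŝ ⇔ ((∃ λ x → x ∈ ∁ S × x ≢ u × embL m u x ≡ w)
                            ⊎ (∃ λ y → y ∈ ∁ S' × y ≢ u' × embR n u' y ≡ w)
                            ⊎ w ≡ hub {n} {m})))
proposition5p8 {n} {m} G u G' u' Ŝ maxŜ hub∉Ŝ =
    (maximalFailed⇒minimalFort H maxŜ , x∉p⇒x∈∁p hub∉Ŝ)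
  , (maxS , maxS' , Ŝ-split hub∉Ŝ)
  , (maximalFailed⇒minimalFort G maxS , maximalFailed⇒minimalFort G' maxS' , F̂-split hub∉Ŝ)
  where
    open VertexSum G u G' u'
    open Split Ŝ
    maxS : IsMaximalFailedZeroForcingSet G (restrictL m u Ŝ)
    maxS = Left.pullback-maximalFailed maxŜ (subst (_∉ Ŝ) (sym embL-u) hub∉Ŝ)
    maxS' : IsMaximalFailedZeroForcingSet G' (restrictR n u' Ŝ)
    maxS' = Right.pullback-maximalFailed maxŜ (subst (_∉ Ŝ) (sym embR-u) hub∉Ŝ)
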